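{- Let $a_1,b_1,a_2,b_2$ be complex numbers, $p_1,p_2$ non-negative integers, $k$ a non-negative integer, and $m$ any positive integer. Then $$S_{a_1,b_1}^{a_2,b_2,p_2}(p_1,k)=\sum_{j_1=0}^{p_1}\sum_{j_2=0}^{p_2}\binom{p_1}{j_1}\binom{p_2}{j_2}a_1^{j_1}a_2^{j_2}(b_1-a_1m)^{p_1-j_1}(b_2-a_2m)^{p_2-j_2}\sum_{t=0}^{m-1}(-1)^t s(m,m-t)\,S(j_1+j_2+m-t,k+m).$$
   Context: For complex numbers $a_1,b_1,a_2,b_2$, non-negative integers $p_1,p_2$ and a non-negative integer $k$, the generalized Stirling number of the second kind is $$S_{a_1,b_1}^{a_2,b_2,p_2}(p_1,k)=\frac{1}{k!}\sum_{j=0}^{k}(-1)^j\binom{k}{j}\bigl(a_1(k-j)+b_1\bigr)^{p_1}\bigl(a_2(k-j)+b_2\bigr)^{p_2},$$ with $0^0=1$. $S(n,k)$ denotes the Stirling numbers of the second kind (zero if $k<0$ or $k>n$). $s(n,k)$ denotes the unsigned Stirling numbers of the first kind, determined by $s(0,0)=1$, $s(n,k)=0$ if $k<0$ or $k>n$ or ($n>0$, $k=0$), and $s(n,k)=s(n-1,k-1)+(n-1)s(n-1,k)$. -}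

module Defs where

open import Level using (Level)
open import Data.Nat as ℕ using (ℕ; zero; suc; _∸_)
open import Data.Nat.Combinatorics using (_C_)
open import Algebra.Bundles using (CommutativeRing)

S₂ : ℕ → ℕ → ℕ
S₂ zero    zero    = 1
S₂ zero    (suc k) = 0
S₂ (suc n) zero    = 0
S₂ (suc n) (suc k) = S₂ n k ℕ.+ suc k ℕ.* S₂ n (suc k)

-- unsigned Stirling numbers of the first kind s(n,k):
-- s(0,0)=1, s(n,k)=s(n-1,k-1)+(n-1)s(n-1,k)
s₁ : ℕ → ℕ → ℕ
s₁ zero    zero    = 1
s₁ zero    (suc k) = 0
s₁ (suc n) zero    = 0
s₁ (suc n) (suc k) = s₁ n k ℕ.+ n ℕ.* s₁ n (suc k)

module Gen {c ℓ : Level} (R : CommutativeRing c ℓ) where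
  open CommutativeRing R

  ι : ℕ → Carrier
  ι zero    = 0#
  ι (suc n) = 1# + ι n

  pow : Carrier → ℕ → Carrier
  pow x zero    = 1#
  pow x (suc n) = x * pow x n

  sgn : ℕ → Carrier
  sgn zero    = 1#
  sgn (suc j) = - sgn j

  Σ≤ : ℕ → (ℕ → Carrier) → Carrier
  Σ≤ zero    f = f 0
  Σ≤ (suc n) f = Σ≤ n f + f (suc n)

  Σ< : ℕ → (ℕ → Carrier) → Carrier
  Σ< zero    f = 0#
  Σ< (suc n) f = Σ< n f + f n

  -- generalized Stirling number S_{a1,b1}^{a2,b2,p2}(p1,k), where kinv is
  -- a (given) inverse of k! in R, playing the role of 1/k!
  genS : (kinv a₁ b₁ a₂ b₂ : Carrier) (p₂ p₁ k : ℕ) → Carrier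
  genS kinv a₁ b₁ a₂ b₂ p₂ p₁ k =
    kinv * Σ≤ k (λ j → sgn j * ι (k C j)
                        * pow (a₁ * ι (k ∸ j) + b₁) p₁
                        * pow (a₂ * ι (k ∸ j) + b₂) p₂)

  rhs : (a₁ b₁ a₂ b₂ : Carrier) (p₁ p₂ k m : ℕ) → Carrier
  rhs a₁ b₁ a₂ b₂ p₁ p₂ k m =
    Σ≤ p₁ (λ j₁ → Σ≤ p₂ (λ j₂ →
      ι (p₁ C j₁) * ι (p₂ C j₂) * pow a₁ j₁ * pow a₂ j₂
      * pow (b₁ - a₁ * ι m) (p₁ ∸ j₁) * pow (b₂ - a₂ * ι m) (p₂ ∸ j₂)
      * Σ< m (λ t → sgn t * ι (s₁ m (m ∸ t)) * ι (S₂ (j₁ ℕ.+ j₂ ℕ.+ m ∸ t) (k ℕ.+ m)))))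

{-# OPTIONS --safe #-}

-- Write Δᵏf(m) = Σⱼ (-1)ʲ C(k,j) f(m+k-j) for the k-th forward difference. Since
-- a(k-j) + b = a(k-j+m) + (b - am), the generalized Stirling number is Δᵏ/k! of the
-- product (a₁x + b₁ - a₁m)^p₁ (a₂x + b₂ - a₂m)^p₂ at x = m; expanding both powers
-- binomially reduces everything to the monomial case
--   Δᵏ xⁿ (m) = k! Σ_{t<m} (-1)ᵗ s(m,m-t) S(n+m-t,k+m).
-- Both sides satisfy the same recurrence in (n,k): on the left the Leibniz rule
-- Δᵏ⁺¹(x f) = (k+1+m) Δᵏ⁺¹f + (k+1) Δᵏf, on the right the recurrence of S. They
-- agree for k = 0, where the right side is mⁿ; this is proved by induction on m ≥ 1
-- from the recurrence of s together with the case k = 1 for m.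

module Submission where

open import Level using (Level)
open import Algebra.Bundles using (CommutativeRing)
open import Algebra.Solver.Ring.AlmostCommutativeRing
  using (fromCommutativeRing; _-Raw-AlmostCommutative⟶_)
open import Data.Nat as ℕ using (ℕ; zero; suc; _∸_; _≤_; _<_; z≤n; s≤s; _!)
import Data.Nat.Properties as ℕ
open import Data.Nat.Combinatorics using (_C_; nCk+nC[k+1]≡[n+1]C[k+1]; k>n⇒nCk≡0)
open import Data.Integer as ℤ using (ℤ; +_; -[1+_]; _⊖_)
import Data.Integer.Properties as ℤ
open import Data.Sign as Sign using (Sign)
open import Data.Fin using (toℕ)
import Data.Maybe as Maybe
open import Relation.Nullary.Decidable using (dec⇒maybe)
open import Relation.Binary.PropositionalEquality as ≡ using (_≡_)
open import Defs

S₂-vanishes : ∀ {n k} → n < k → S₂ n k ≡ 0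
S₂-vanishes {zero}  {suc k} _         = ≡.refl
S₂-vanishes {suc n} {suc k} (s≤s n<k)
  rewrite S₂-vanishes n<k | S₂-vanishes (ℕ.m<n⇒m<1+n n<k) = ℕ.*-zeroʳ k

s₁-vanishes : ∀ {n k} → n < k → s₁ n k ≡ 0
s₁-vanishes {zero}  {suc k} _         = ≡.refl
s₁-vanishes {suc n} {suc k} (s≤s n<k)
  rewrite s₁-vanishes n<k | s₁-vanishes (ℕ.m<n⇒m<1+n n<k) = ℕ.*-zeroʳ n

s₁-zero : ∀ {m} → 1 ≤ m → s₁ m 0 ≡ 0
s₁-zero (s≤s _) = ≡.refl

S₂-suc-1 : ∀ n → S₂ (suc n) 1 ≡ 1
S₂-suc-1 zero    = ≡.refl
S₂-suc-1 (suc n) = ≡.trans (ℕ.+-identityʳ _) (S₂-suc-1 n)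

module ForwardDifferences {c ℓ : Level} (R : CommutativeRing c ℓ) where

  open CommutativeRing R hiding (zero)
  open Gen R
  open import Relation.Binary.Reasoning.Setoid setoid
  open import Algebra.Properties.Ring ring
    using (-‿involutive; -0#≈0#; -1*x≈-x; -‿distribʳ-*)
  open import Algebra.Properties.AbelianGroup +-abelianGroup using (⁻¹-∙-comm)
  open import Algebra.Properties.CommutativeSemigroup +-commutativeSemigroup
    using () renaming (interchange to +-interchange)
  open import Algebra.Properties.CommutativeSemigroup *-commutativeSemigroup
    using (x∙yz≈y∙xz) renaming (interchange to *-interchange)
  open import Algebra.Properties.Semiring.Mult semiring
    using (_×_; ×-congʳ; ×-homo-+; ×1-homo-*; ×-assoc-*)
  open import Algebra.Properties.Semiring.Exp semiring using (_^_; ^-congˡ; ^-homo-*)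
  open import Algebra.Properties.CommutativeSemiring.Exp commutativeSemiring using (^-distrib-*)
  open import Algebra.Properties.Semiring.Sum semiring using (sum⁺-syntax)
  import Algebra.Properties.CommutativeSemiring.Binomial commutativeSemiring as Binomial

  ι≡×1# : ∀ n → ι n ≡ n × 1#
  ι≡×1# zero    = ≡.refl
  ι≡×1# (suc n) = ≡.cong (λ x → 1# + x) (ι≡×1# n)

  ι-+ : ∀ m n → ι (m ℕ.+ n) ≈ ι m + ι n
  ι-+ m n rewrite ι≡×1# (m ℕ.+ n) | ι≡×1# m | ι≡×1# n = ×-homo-+ 1# m n

  ι-* : ∀ m n → ι (m ℕ.* n) ≈ ι m * ι n
  ι-* m n rewrite ι≡×1# (m ℕ.* n) | ι≡×1# m | ι≡×1# n = ×1-homo-* m n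

  ι*≈× : ∀ n x → ι n * x ≈ n × x
  ι*≈× n x rewrite ι≡×1# n = trans (×-assoc-* n 1# x) (×-congʳ n (*-identityˡ x))

  ι1* : ∀ x → ι 1 * x ≈ x
  ι1* x = trans (*-congʳ (+-identityʳ 1#)) (*-identityˡ x)

  -- The ring solver is instantiated with integer coefficients, so that it can
  -- cancel terms such as x - x; this needs the canonical map ℤ → R.
  ⟦_⟧ℤ : ℤ → Carrier
  ⟦ + n      ⟧ℤ = ι n
  ⟦ -[1+ n ] ⟧ℤ = - ι (suc n)

  ⟦-⟧ℤ : ∀ i → ⟦ ℤ.- i ⟧ℤ ≈ - ⟦ i ⟧ℤ
  ⟦-⟧ℤ (+ zero)  = sym -0#≈0#
  ⟦-⟧ℤ (+ suc n) = refl
  ⟦-⟧ℤ -[1+ n ]  = sym (-‿involutive _)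

  ⟦⊖⟧ℤ : ∀ m n → ⟦ m ⊖ n ⟧ℤ ≈ ι m - ι n
  ⟦⊖⟧ℤ zero    zero    = sym (-‿inverseʳ 0#)
  ⟦⊖⟧ℤ zero    (suc n) = sym (+-identityˡ _)
  ⟦⊖⟧ℤ (suc m) zero    = sym (trans (+-congˡ -0#≈0#) (+-identityʳ _))
  ⟦⊖⟧ℤ (suc m) (suc n) = begin
    ⟦ suc m ⊖ suc n ⟧ℤ           ≡⟨ ≡.cong ⟦_⟧ℤ (ℤ.[1+m]⊖[1+n]≡m⊖n m n) ⟩
    ⟦ m ⊖ n ⟧ℤ                   ≈⟨ ⟦⊖⟧ℤ m n ⟩
    ι m - ι n                    ≈⟨ +-identityˡ _ ⟨
    0# + (ι m - ι n)             ≈⟨ +-congʳ (-‿inverseʳ 1#) ⟨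
    (1# - 1#) + (ι m - ι n)      ≈⟨ +-interchange 1# (- 1#) (ι m) (- ι n) ⟩
    (1# + ι m) + (- 1# + - ι n)  ≈⟨ +-congˡ (⁻¹-∙-comm 1# (ι n)) ⟩
    (1# + ι m) - (1# + ι n)      ∎

  ⟦+⟧ℤ : ∀ i j → ⟦ i ℤ.+ j ⟧ℤ ≈ ⟦ i ⟧ℤ + ⟦ j ⟧ℤ
  ⟦+⟧ℤ (+ m)    (+ n)    = ι-+ m n
  ⟦+⟧ℤ (+ m)    -[1+ n ] = ⟦⊖⟧ℤ m (suc n)
  ⟦+⟧ℤ -[1+ m ] (+ n)    = trans (⟦⊖⟧ℤ n (suc m)) (+-comm _ _)
  ⟦+⟧ℤ -[1+ m ] -[1+ n ] = begin
    - ι (suc (suc (m ℕ.+ n)))  ≡⟨ ≡.cong (λ z → - ι (suc z)) (ℕ.+-suc m n) ⟨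
    - ι (suc m ℕ.+ suc n)      ≈⟨ -‿cong (ι-+ (suc m) (suc n)) ⟩
    - (ι (suc m) + ι (suc n))  ≈⟨ ⁻¹-∙-comm _ _ ⟨
    - ι (suc m) + - ι (suc n)  ∎

  signed : Sign → Carrier
  signed Sign.+ = 1#
  signed Sign.- = - 1#

  signed-* : ∀ s t → signed (s Sign.* t) ≈ signed s * signed t
  signed-* Sign.+ t      = sym (*-identityˡ _)
  signed-* Sign.- Sign.+ = sym (*-identityʳ _)
  signed-* Sign.- Sign.- = sym (trans (-1*x≈-x _) (-‿involutive _))

  ⟦◃⟧ℤ : ∀ s n → ⟦ s ℤ.◃ n ⟧ℤ ≈ signed s * ι n
  ⟦◃⟧ℤ s      zero    = sym (zeroʳ _)
  ⟦◃⟧ℤ Sign.+ (suc n) = sym (*-identityˡ _)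
  ⟦◃⟧ℤ Sign.- (suc n) = sym (-1*x≈-x _)

  ⟦*⟧ℤ : ∀ i j → ⟦ i ℤ.* j ⟧ℤ ≈ ⟦ i ⟧ℤ * ⟦ j ⟧ℤ
  ⟦*⟧ℤ i j = begin
    ⟦ i ℤ.* j ⟧ℤ
      ≈⟨ ⟦◃⟧ℤ (sᵢ Sign.* sⱼ) (∣ᵢ∣ ℕ.* ∣ⱼ∣) ⟩
    signed (sᵢ Sign.* sⱼ) * ι (∣ᵢ∣ ℕ.* ∣ⱼ∣)
      ≈⟨ *-cong (signed-* sᵢ sⱼ) (ι-* ∣ᵢ∣ ∣ⱼ∣) ⟩
    (signed sᵢ * signed sⱼ) * (ι ∣ᵢ∣ * ι ∣ⱼ∣)
      ≈⟨ *-interchange _ _ _ _ ⟩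
    (signed sᵢ * ι ∣ᵢ∣) * (signed sⱼ * ι ∣ⱼ∣)
      ≈⟨ *-cong (⟦◃⟧ℤ sᵢ ∣ᵢ∣) (⟦◃⟧ℤ sⱼ ∣ⱼ∣) ⟨
    ⟦ sᵢ ℤ.◃ ∣ᵢ∣ ⟧ℤ * ⟦ sⱼ ℤ.◃ ∣ⱼ∣ ⟧ℤ
      ≡⟨ ≡.cong₂ (λ x y → ⟦ x ⟧ℤ * ⟦ y ⟧ℤ) (ℤ.◃-inverse i) (ℤ.◃-inverse j) ⟩
    ⟦ i ⟧ℤ * ⟦ j ⟧ℤ ∎
    where
    sᵢ sⱼ : Sign
    sᵢ = ℤ.sign i
    sⱼ = ℤ.sign j
    ∣ᵢ∣ ∣ⱼ∣ : ℕ
    ∣ᵢ∣ = ℤ.∣ i ∣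
    ∣ⱼ∣ = ℤ.∣ j ∣

  ℤ-morphism : ℤ.+-*-rawRing -Raw-AlmostCommutative⟶ fromCommutativeRing R
  ℤ-morphism = record
    { ⟦_⟧    = ⟦_⟧ℤ
    ; +-homo = ⟦+⟧ℤ
    ; *-homo = ⟦*⟧ℤ
    ; -‿homo = ⟦-⟧ℤ
    ; 0-homo = refl
    ; 1-homo = +-identityʳ 1#
    }

  -- The solver's constant 1 denotes ι 1 = 1# + 0#, not 1#; so below 1# is passed
  -- to the solver as a variable whenever it occurs in a goal.
  open import Algebra.Solver.Ring ℤ.+-*-rawRing (fromCommutativeRing R) ℤ-morphism
    (λ i j → Maybe.map (λ i≡j → reflexive (≡.cong ⟦_⟧ℤ i≡j)) (dec⇒maybe (i ℤ.≟ j)))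
    using (solve; _:=_; _:+_; _:*_; :-_; con)

  Σ≤-cong : ∀ n {f g : ℕ → Carrier} → (∀ j → j ≤ n → f j ≈ g j) → Σ≤ n f ≈ Σ≤ n g
  Σ≤-cong zero    f≈g = f≈g 0 z≤n
  Σ≤-cong (suc n) f≈g =
    +-cong (Σ≤-cong n (λ j j≤n → f≈g j (ℕ.m≤n⇒m≤1+n j≤n))) (f≈g (suc n) ℕ.≤-refl)

  Σ≤-+ : ∀ n (f g : ℕ → Carrier) → Σ≤ n (λ j → f j + g j) ≈ Σ≤ n f + Σ≤ n g
  Σ≤-+ zero    f g = refl
  Σ≤-+ (suc n) f g = trans (+-congʳ (Σ≤-+ n f g)) (+-interchange _ _ _ _)

  Σ≤-*ˡ : ∀ n x (f : ℕ → Carrier) → x * Σ≤ n f ≈ Σ≤ n (λ j → x * f j)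
  Σ≤-*ˡ zero    x f = refl
  Σ≤-*ˡ (suc n) x f = trans (distribˡ _ _ _) (+-congʳ (Σ≤-*ˡ n x f))

  Σ≤-*ʳ : ∀ n x (f : ℕ → Carrier) → Σ≤ n f * x ≈ Σ≤ n (λ j → f j * x)
  Σ≤-*ʳ n x f = trans (*-comm _ _) (trans (Σ≤-*ˡ n x f) (Σ≤-cong n (λ j _ → *-comm _ _)))

  Σ≤-neg : ∀ n (f : ℕ → Carrier) → Σ≤ n (λ j → - f j) ≈ - Σ≤ n f
  Σ≤-neg zero    f = refl
  Σ≤-neg (suc n) f = trans (+-congʳ (Σ≤-neg n f)) (⁻¹-∙-comm _ _)

  Σ≤-shift : ∀ n (f : ℕ → Carrier) → Σ≤ (suc n) f ≈ f 0 + Σ≤ n (λ j → f (suc j))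
  Σ≤-shift zero    f = refl
  Σ≤-shift (suc n) f = trans (+-congʳ (Σ≤-shift n f)) (+-assoc _ _ _)

  Σ≤-comm : ∀ m n (f : ℕ → ℕ → Carrier) →
            Σ≤ m (λ i → Σ≤ n (λ j → f i j)) ≈ Σ≤ n (λ j → Σ≤ m (λ i → f i j))
  Σ≤-comm zero    n f = refl
  Σ≤-comm (suc m) n f = trans (+-congʳ (Σ≤-comm m n f)) (sym (Σ≤-+ n _ _))

  Σ≤≈∑ : ∀ n (f : ℕ → Carrier) → Σ≤ n f ≈ ∑[ i ≤ n ] f (toℕ i)
  Σ≤≈∑ zero    f = sym (+-identityʳ _)
  Σ≤≈∑ (suc n) f = trans (Σ≤-shift n f) (+-congˡ (Σ≤≈∑ n (λ j → f (suc j))))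

  Σ<-cong : ∀ n {f g : ℕ → Carrier} → (∀ j → j < n → f j ≈ g j) → Σ< n f ≈ Σ< n g
  Σ<-cong zero    f≈g = refl
  Σ<-cong (suc n) f≈g =
    +-cong (Σ<-cong n (λ j j<n → f≈g j (ℕ.m<n⇒m<1+n j<n))) (f≈g n ℕ.≤-refl)

  Σ<-+ : ∀ n (f g : ℕ → Carrier) → Σ< n (λ j → f j + g j) ≈ Σ< n f + Σ< n g
  Σ<-+ zero    f g = sym (+-identityʳ _)
  Σ<-+ (suc n) f g = trans (+-congʳ (Σ<-+ n f g)) (+-interchange _ _ _ _)

  Σ<-*ˡ : ∀ n x (f : ℕ → Carrier) → x * Σ< n f ≈ Σ< n (λ j → x * f j)
  Σ<-*ˡ zero    x f = zeroʳ _
  Σ<-*ˡ (suc n) x f = trans (distribˡ _ _ _) (+-congʳ (Σ<-*ˡ n x f))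

  Σ<-neg : ∀ n (f : ℕ → Carrier) → Σ< n (λ j → - f j) ≈ - Σ< n f
  Σ<-neg zero    f = sym -0#≈0#
  Σ<-neg (suc n) f = trans (+-congʳ (Σ<-neg n f)) (⁻¹-∙-comm _ _)

  Σ<-shift : ∀ n (f : ℕ → Carrier) → Σ< (suc n) f ≈ f 0 + Σ< n (λ j → f (suc j))
  Σ<-shift zero    f = trans (+-identityˡ _) (sym (+-identityʳ _))
  Σ<-shift (suc n) f = trans (+-congʳ (Σ<-shift n f)) (+-assoc _ _ _)

  Σ<-zero : ∀ n (f : ℕ → Carrier) → (∀ j → j < n → f j ≈ 0#) → Σ< n f ≈ 0#
  Σ<-zero zero    f f≈0 = refl
  Σ<-zero (suc n) f f≈0 = trans
    (+-cong (Σ<-zero n f (λ j j<n → f≈0 j (ℕ.m<n⇒m<1+n j<n))) (f≈0 n ℕ.≤-refl))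
    (+-identityˡ _)

  pow≡^ : ∀ x n → pow x n ≡ x ^ n
  pow≡^ x zero    = ≡.refl
  pow≡^ x (suc n) = ≡.cong (x *_) (pow≡^ x n)

  pow-cong : ∀ n {x y} → x ≈ y → pow x n ≈ pow y n
  pow-cong n {x} {y} x≈y rewrite pow≡^ x n | pow≡^ y n = ^-congˡ n x≈y

  pow-distrib-* : ∀ x y n → pow (x * y) n ≈ pow x n * pow y n
  pow-distrib-* x y n rewrite pow≡^ (x * y) n | pow≡^ x n | pow≡^ y n = ^-distrib-* x y n

  pow-homo-+ : ∀ x m n → pow x (m ℕ.+ n) ≈ pow x m * pow x n
  pow-homo-+ x m n rewrite pow≡^ x (m ℕ.+ n) | pow≡^ x m | pow≡^ x n = ^-homo-* x m n

  pow-1# : ∀ n → pow 1# n ≈ 1#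
  pow-1# zero    = refl
  pow-1# (suc n) = trans (*-identityˡ _) (pow-1# n)

  binomial : ∀ x y n → pow (x + y) n ≈ Σ≤ n (λ j → ι (n C j) * (pow x j * pow y (n ∸ j)))
  binomial x y n = begin
    pow (x + y) n                                             ≡⟨ pow≡^ (x + y) n ⟩
    (x + y) ^ n                                               ≈⟨ Binomial.theorem n x y ⟩
    ∑[ j ≤ n ] ((n C toℕ j) × (x ^ toℕ j * y ^ (n ∸ toℕ j)))  ≈⟨ Σ≤≈∑ n _ ⟨
    Σ≤ n (λ j → (n C j) × (x ^ j * y ^ (n ∸ j)))              ≈⟨ Σ≤-cong n (λ j _ → term j) ⟨
    Σ≤ n (λ j → ι (n C j) * (pow x j * pow y (n ∸ j)))        ∎
    where
    term : ∀ j → ι (n C j) * (pow x j * pow y (n ∸ j)) ≈ (n C j) × (x ^ j * y ^ (n ∸ j))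
    term j rewrite pow≡^ x j | pow≡^ y (n ∸ j) = ι*≈× (n C j) _

  Σ≤-pascal : ∀ n (g : ℕ → Carrier) →
    Σ≤ (suc n) (λ j → ι (suc n C j) * g j) ≈
    Σ≤ n (λ j → ι (n C j) * g j) + Σ≤ n (λ j → ι (n C j) * g (suc j))
  Σ≤-pascal n g = begin
    Σ≤ (suc n) (λ j → ι (suc n C j) * g j)
      ≈⟨ Σ≤-shift n _ ⟩
    ι (n C 0) * g 0 + Σ≤ n (λ j → ι (suc n C suc j) * g (suc j))
      ≈⟨ +-congˡ (trans (Σ≤-cong n (λ j _ → split j)) (Σ≤-+ n _ _)) ⟩
    ι (n C 0) * g 0 + (B + A)
      ≈⟨ solve 3 (λ a b c → a :+ (b :+ c) := (a :+ c) :+ b) refl _ _ _ ⟩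
    (ι (n C 0) * g 0 + A) + B
      ≈⟨ +-congʳ (Σ≤-shift n _) ⟨
    Σ≤ (suc n) (λ j → ι (n C j) * g j) + B
      ≈⟨ +-congʳ (trans (+-congˡ last≈0) (+-identityʳ _)) ⟩
    Σ≤ n (λ j → ι (n C j) * g j) + B ∎
    where
    A B : Carrier
    A = Σ≤ n (λ j → ι (n C suc j) * g (suc j))
    B = Σ≤ n (λ j → ι (n C j) * g (suc j))
    split : ∀ j → ι (suc n C suc j) * g (suc j) ≈ ι (n C j) * g (suc j) + ι (n C suc j) * g (suc j)
    split j = begin
      ι (suc n C suc j) * g (suc j)
        ≡⟨ ≡.cong (λ x → ι x * g (suc j)) (nCk+nC[k+1]≡[n+1]C[k+1] n j) ⟨
      ι (n C j ℕ.+ n C suc j) * g (suc j)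
        ≈⟨ trans (*-congʳ (ι-+ (n C j) (n C suc j))) (distribʳ _ _ _) ⟩
      ι (n C j) * g (suc j) + ι (n C suc j) * g (suc j) ∎
    last≈0 : ι (n C suc n) * g (suc n) ≈ 0#
    last≈0 = trans (*-congʳ (reflexive (≡.cong ι (k>n⇒nCk≡0 (ℕ.n<1+n n))))) (zeroˡ _)

  monomial : ℕ → ℕ → Carrier
  monomial n x = pow (ι x) n

  Δ : ℕ → ℕ → (ℕ → Carrier) → Carrier
  Δ k m f = Σ≤ k (λ j → ι (k C j) * (sgn j * f (k ∸ j ℕ.+ m)))

  Δ-cong : ∀ k m {f g : ℕ → Carrier} → (∀ x → f x ≈ g x) → Δ k m f ≈ Δ k m g
  Δ-cong k m f≈g = Σ≤-cong k (λ j _ → *-congˡ (*-congˡ (f≈g _)))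

  Δ-zero : ∀ m f → Δ 0 m f ≈ f m
  Δ-zero m f = trans (*-cong (+-identityʳ 1#) (*-identityˡ _)) (*-identityˡ _)

  Δ-suc : ∀ k m f → Δ (suc k) m f ≈ Δ k (suc m) f - Δ k m f
  Δ-suc k m f = begin
    Δ (suc k) m f
      ≈⟨ Σ≤-pascal k _ ⟩
    Σ≤ k (λ j → ι (k C j) * (sgn j * f (suc k ∸ j ℕ.+ m)))
      + Σ≤ k (λ j → ι (k C j) * (- sgn j * f (k ∸ j ℕ.+ m)))
      ≈⟨ +-cong (Σ≤-cong k (λ j j≤k → *-congˡ (*-congˡ (reflexive (≡.cong f (shift j j≤k))))))
                (trans (Σ≤-cong k (λ j _ → negate _ _ _)) (Σ≤-neg k _)) ⟩
    Δ k (suc m) f - Δ k m f ∎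
    where
    shift : ∀ j → j ≤ k → suc k ∸ j ℕ.+ m ≡ k ∸ j ℕ.+ suc m
    shift j j≤k = ≡.trans (≡.cong (ℕ._+ m) (ℕ.+-∸-assoc 1 j≤k)) (≡.sym (ℕ.+-suc (k ∸ j) m))
    negate : ∀ c s x → c * (- s * x) ≈ - (c * (s * x))
    negate = solve 3 (λ c s x → c :* (:- s :* x) := :- (c :* (s :* x))) refl

  Δ-one : ∀ m f → Δ 1 m f ≈ f (suc m) - f m
  Δ-one m f = trans (Δ-suc 0 m f) (+-cong (Δ-zero (suc m) f) (-‿cong (Δ-zero m f)))

  Δ-const : ∀ k m x → Δ (suc k) m (λ _ → x) ≈ 0#
  Δ-const k m x = trans (Δ-suc k m (λ _ → x)) (-‿inverseʳ _)

  Δ-*ˡ : ∀ k m x f → Δ k m (λ y → x * f y) ≈ x * Δ k m f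
  Δ-*ˡ k m x f = trans (Σ≤-cong k (λ j _ → pull _ _ _)) (sym (Σ≤-*ˡ k x _))
    where
    pull : ∀ c s y → c * (s * (x * y)) ≈ x * (c * (s * y))
    pull c s y = solve 4 (λ c s y x → c :* (s :* (x :* y)) := x :* (c :* (s :* y))) refl c s y x

  Δ-Σ≤ : ∀ k m n (f : ℕ → ℕ → Carrier) →
    Δ k m (λ y → Σ≤ n (λ i → f i y)) ≈ Σ≤ n (λ i → Δ k m (f i))
  Δ-Σ≤ k m n f = begin
    Δ k m (λ y → Σ≤ n (λ i → f i y))
      ≈⟨ Σ≤-cong k (λ j _ → trans (*-congˡ (Σ≤-*ˡ n _ _)) (Σ≤-*ˡ n _ _)) ⟩
    Σ≤ k (λ j → Σ≤ n (λ i → ι (k C j) * (sgn j * f i (k ∸ j ℕ.+ m))))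
      ≈⟨ Σ≤-comm k n _ ⟩
    Σ≤ n (λ i → Δ k m (f i)) ∎

  Δ-leibniz : ∀ k m f →
    Δ (suc k) m (λ x → ι x * f x) ≈ ι (suc k ℕ.+ m) * Δ (suc k) m f + ι (suc k) * Δ k m f
  Δ-leibniz zero m f = begin
    Δ 1 m (λ x → ι x * f x)
      ≈⟨ Δ-one m (λ x → ι x * f x) ⟩
    (1# + ι m) * f (suc m) - ι m * f m
      ≈⟨ solve 4 (λ one μ a b → (one :+ μ) :* a :+ :- (μ :* b)
                             := (one :+ μ) :* (a :+ :- b) :+ one :* b) refl 1# (ι m) _ _ ⟩
    (1# + ι m) * (f (suc m) - f m) + 1# * f m
      ≈⟨ +-cong (*-congˡ (Δ-one m f)) (*-cong (+-identityʳ 1#) (Δ-zero m f)) ⟨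
    ι (1 ℕ.+ m) * Δ 1 m f + ι 1 * Δ 0 m f ∎
  Δ-leibniz (suc k) m f = begin
    Δ (suc (suc k)) m (λ x → ι x * f x)
      ≈⟨ Δ-suc (suc k) m (λ x → ι x * f x) ⟩
    Δ (suc k) (suc m) (λ x → ι x * f x) - Δ (suc k) m (λ x → ι x * f x)
      ≈⟨ +-cong (Δ-leibniz k (suc m) f) (-‿cong (Δ-leibniz k m f)) ⟩
    (ι (suc k ℕ.+ suc m) * A₁ + κ * B₁) - (N * A₀ + κ * B₀)
      ≡⟨ ≡.cong (λ n → (ι n * A₁ + κ * B₁) - (N * A₀ + κ * B₀)) (ℕ.+-suc (suc k) m) ⟩
    ((1# + N) * A₁ + κ * B₁) - (N * A₀ + κ * B₀)
      ≈⟨ solve 7 (λ one N κ A₁ A₀ B₁ B₀ →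
                    ((one :+ N) :* A₁ :+ κ :* B₁) :+ :- (N :* A₀ :+ κ :* B₀)
                 := (one :+ N) :* (A₁ :+ :- A₀) :+ (one :+ κ) :* A₀
                      :+ κ :* ((B₁ :+ :- B₀) :+ :- A₀))
                 refl 1# N κ A₁ A₀ B₁ B₀ ⟩
    (1# + N) * (A₁ - A₀) + (1# + κ) * A₀ + κ * ((B₁ - B₀) - A₀)
      ≈⟨ +-cong (+-congʳ (*-congˡ (sym (Δ-suc (suc k) m f)))) κ[B₁-B₀-A₀]≈0 ⟩
    ι (suc (suc k) ℕ.+ m) * Δ (suc (suc k)) m f + ι (suc (suc k)) * A₀ + 0#
      ≈⟨ +-identityʳ _ ⟩
    ι (suc (suc k) ℕ.+ m) * Δ (suc (suc k)) m f + ι (suc (suc k)) * A₀ ∎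
    where
    N κ A₁ A₀ B₁ B₀ : Carrier
    N  = ι (suc k ℕ.+ m)
    κ  = ι (suc k)
    A₁ = Δ (suc k) (suc m) f
    A₀ = Δ (suc k) m f
    B₁ = Δ k (suc m) f
    B₀ = Δ k m f
    κ[B₁-B₀-A₀]≈0 : κ * ((B₁ - B₀) - A₀) ≈ 0#
    κ[B₁-B₀-A₀]≈0 =
      trans (*-congˡ (trans (+-congʳ (sym (Δ-suc k m f))) (-‿inverseʳ _))) (zeroʳ κ)

  -- By Δ-monomial≈k!*stirlingSum, this is the r-Stirling number S_m(n+m, k+m).
  stirlingSum : ℕ → ℕ → ℕ → Carrier
  stirlingSum n k m = Σ< m (λ t → sgn t * ι (s₁ m (m ∸ t)) * ι (S₂ (n ℕ.+ m ∸ t) (k ℕ.+ m)))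

  stirlingSum-recurrence : ∀ n k m →
    stirlingSum (suc n) (suc k) m ≈ stirlingSum n k m + ι (suc k ℕ.+ m) * stirlingSum n (suc k) m
  stirlingSum-recurrence n k m = begin
    stirlingSum (suc n) (suc k) m                            ≈⟨ Σ<-cong m split ⟩
    Σ< m (λ t → A t + ι (suc k ℕ.+ m) * B t)                 ≈⟨ Σ<-+ m _ _ ⟩
    stirlingSum n k m + Σ< m (λ t → ι (suc k ℕ.+ m) * B t)   ≈⟨ +-congˡ (Σ<-*ˡ m _ _) ⟨
    stirlingSum n k m + ι (suc k ℕ.+ m) * stirlingSum n (suc k) m ∎
    where
    S : ℕ → ℕ → ℕ
    S k′ t = S₂ (n ℕ.+ m ∸ t) (k′ ℕ.+ m)
    σ A B : ℕ → Carrier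
    σ t = sgn t * ι (s₁ m (m ∸ t))
    A t = σ t * ι (S k t)
    B t = σ t * ι (S (suc k) t)
    split : ∀ t → t < m → σ t * ι (S₂ (suc n ℕ.+ m ∸ t) (suc k ℕ.+ m)) ≈ A t + ι (suc k ℕ.+ m) * B t
    split t t<m = begin
      σ t * ι (S₂ (suc n ℕ.+ m ∸ t) (suc k ℕ.+ m))
        ≡⟨ ≡.cong (λ x → σ t * ι (S₂ x (suc k ℕ.+ m))) (ℕ.+-∸-assoc 1 t≤n+m) ⟩
      σ t * ι (S k t ℕ.+ (suc k ℕ.+ m) ℕ.* S (suc k) t)
        ≈⟨ *-congˡ (trans (ι-+ (S k t) _) (+-congˡ (ι-* (suc k ℕ.+ m) (S (suc k) t)))) ⟩
      σ t * (ι (S k t) + ι (suc k ℕ.+ m) * ι (S (suc k) t))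
        ≈⟨ trans (distribˡ _ _ _) (+-congˡ (x∙yz≈y∙xz _ _ _)) ⟩
      A t + ι (suc k ℕ.+ m) * B t ∎
      where
      t≤n+m : t ≤ n ℕ.+ m
      t≤n+m = ℕ.≤-trans (ℕ.<⇒≤ t<m) (ℕ.m≤n+m m n)

  stirlingSum-vanishes : ∀ k m → stirlingSum 0 (suc k) m ≈ 0#
  stirlingSum-vanishes k m = Σ<-zero m _ (λ t _ → trans (*-congˡ (reflexive (≡.cong ι (S₂-vanishes
    (s≤s (ℕ.≤-trans (ℕ.m∸n≤m m t) (ℕ.m≤n+m m k))))))) (zeroʳ _))

  Δ-monomial-from-row-zero : ∀ m → (∀ n → stirlingSum n 0 m ≈ monomial n m) →
    ∀ n k → Δ k m (monomial n) ≈ ι (k !) * stirlingSum n k m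
  Δ-monomial-from-row-zero m row n zero =
    trans (Δ-zero m (monomial n)) (sym (trans (ι1* _) (row n)))
  Δ-monomial-from-row-zero m row zero (suc k) =
    trans (Δ-const k m 1#) (sym (trans (*-congˡ (stirlingSum-vanishes k m)) (zeroʳ _)))
  Δ-monomial-from-row-zero m row (suc n) (suc k) = begin
    Δ (suc k) m (monomial (suc n))
      ≈⟨ Δ-leibniz k m (monomial n) ⟩
    ι (suc k ℕ.+ m) * Δ (suc k) m (monomial n) + ι (suc k) * Δ k m (monomial n)
      ≈⟨ +-cong (*-congˡ (Δ-monomial-from-row-zero m row n (suc k)))
                (*-congˡ (Δ-monomial-from-row-zero m row n k)) ⟩
    ι (suc k ℕ.+ m) * (ι (suc k ℕ.* k !) * F₁) + ι (suc k) * (ι (k !) * F₀)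
      ≈⟨ +-congʳ (*-congˡ (*-congʳ (ι-* (suc k) (k !)))) ⟩
    ι (suc k ℕ.+ m) * ((ι (suc k) * ι (k !)) * F₁) + ι (suc k) * (ι (k !) * F₀)
      ≈⟨ solve 5 (λ N κ f a b → N :* ((κ :* f) :* a) :+ κ :* (f :* b) := (κ :* f) :* (b :+ N :* a))
                 refl _ _ _ _ _ ⟩
    (ι (suc k) * ι (k !)) * (F₀ + ι (suc k ℕ.+ m) * F₁)
      ≈⟨ *-cong (ι-* (suc k) (k !)) (stirlingSum-recurrence n k m) ⟨
    ι (suc k !) * stirlingSum (suc n) (suc k) m ∎
    where
    F₀ F₁ : Carrier
    F₀ = stirlingSum n k m
    F₁ = stirlingSum n (suc k) m

  stirlingSum-row-zero-step : ∀ m n → 1 ≤ m →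
    stirlingSum n 0 (suc m) ≈ stirlingSum (suc n) 1 m - ι m * stirlingSum n 1 m
  stirlingSum-row-zero-step m n 1≤m = begin
    stirlingSum n 0 (suc m)                         ≈⟨ Σ<-cong (suc m) split ⟩
    Σ< (suc m) (λ t → X t + ι m * Y t)              ≈⟨ Σ<-+ (suc m) _ _ ⟩
    Σ< (suc m) X + Σ< (suc m) (λ t → ι m * Y t)     ≈⟨ +-congˡ (Σ<-*ˡ (suc m) _ _) ⟨
    (Σ< m X + X m) + ι m * Σ< (suc m) Y             ≈⟨ +-cong (+-cong ΣX Xm≈0) (*-congˡ (Σ<-shift m Y)) ⟩
    (stirlingSum (suc n) 1 m + 0#) + ι m * (Y 0 + Σ< m (λ u → Y (suc u)))
      ≈⟨ +-cong (+-identityʳ _) (*-congˡ (+-cong Y0≈0 ΣY)) ⟩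
    stirlingSum (suc n) 1 m + ι m * (0# - stirlingSum n 1 m)
      ≈⟨ +-congˡ (trans (*-congˡ (+-identityˡ _)) (sym (-‿distribʳ-* _ _))) ⟩
    stirlingSum (suc n) 1 m - ι m * stirlingSum n 1 m ∎
    where
    S X Y : ℕ → Carrier
    S t = ι (S₂ (n ℕ.+ suc m ∸ t) (suc m))
    X t = sgn t * ι (s₁ m (m ∸ t)) * S t
    Y t = sgn t * ι (s₁ m (suc (m ∸ t))) * S t
    split : ∀ t → t < suc m → sgn t * ι (s₁ (suc m) (suc m ∸ t)) * S t ≈ X t + ι m * Y t
    split t (s≤s t≤m) = begin
      sgn t * ι (s₁ (suc m) (suc m ∸ t)) * S t
        ≡⟨ ≡.cong (λ j → sgn t * ι (s₁ (suc m) j) * S t) (ℕ.+-∸-assoc 1 t≤m) ⟩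
      sgn t * ι (s₁ m (m ∸ t) ℕ.+ m ℕ.* s₁ m (suc (m ∸ t))) * S t
        ≈⟨ *-congʳ (*-congˡ (trans (ι-+ (s₁ m (m ∸ t)) _) (+-congˡ (ι-* m (s₁ m (suc (m ∸ t))))))) ⟩
      sgn t * (ι (s₁ m (m ∸ t)) + ι m * ι (s₁ m (suc (m ∸ t)))) * S t
        ≈⟨ solve 5 (λ s a μ b x → s :* (a :+ μ :* b) :* x := s :* a :* x :+ μ :* (s :* b :* x))
                   refl _ _ _ _ _ ⟩
      X t + ι m * Y t ∎
    vanishing : ∀ t j x → s₁ m j ≡ 0 → sgn t * ι (s₁ m j) * x ≈ 0#
    vanishing t j x s₁≡0 =
      trans (*-congʳ (*-congˡ (reflexive (≡.cong ι s₁≡0)))) (trans (*-congʳ (zeroʳ _)) (zeroˡ x))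
    Xm≈0 : X m ≈ 0#
    Xm≈0 = vanishing m (m ∸ m) (S m) (≡.trans (≡.cong (s₁ m) (ℕ.n∸n≡0 m)) (s₁-zero 1≤m))
    Y0≈0 : Y 0 ≈ 0#
    Y0≈0 = vanishing 0 (suc m) (S 0) (s₁-vanishes (ℕ.n<1+n m))
    ΣX : Σ< m X ≈ stirlingSum (suc n) 1 m
    ΣX = Σ<-cong m (λ t _ → *-congˡ (reflexive (≡.cong (λ z → ι (S₂ (z ∸ t) (suc m))) (ℕ.+-suc n m))))
    ΣY : Σ< m (λ u → Y (suc u)) ≈ - stirlingSum n 1 m
    ΣY = trans (Σ<-cong m Ysuc) (Σ<-neg m _)
      where
      Ysuc : ∀ u → u < m → Y (suc u) ≈ - (sgn u * ι (s₁ m (m ∸ u)) * ι (S₂ (n ℕ.+ m ∸ u) (1 ℕ.+ m)))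
      Ysuc u u<m = begin
        - sgn u * ι (s₁ m (suc (m ∸ suc u))) * ι (S₂ (n ℕ.+ suc m ∸ suc u) (suc m))
          ≡⟨ ≡.cong₂ (λ j i → - sgn u * ι (s₁ m j) * ι (S₂ (i ∸ suc u) (suc m)))
                     (≡.sym (ℕ.+-∸-assoc 1 u<m)) (ℕ.+-suc n m) ⟩
        - sgn u * ι (s₁ m (m ∸ u)) * ι (S₂ (n ℕ.+ m ∸ u) (1 ℕ.+ m))
          ≈⟨ solve 3 (λ s a b → :- s :* a :* b := :- (s :* a :* b)) refl _ _ _ ⟩
        - (sgn u * ι (s₁ m (m ∸ u)) * ι (S₂ (n ℕ.+ m ∸ u) (1 ℕ.+ m))) ∎

  stirlingSum-row-zero : ∀ m n → stirlingSum n 0 (suc m) ≈ monomial n (suc m)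
  stirlingSum-row-zero zero n = begin
    0# + 1# * ι 1 * ι (S₂ (n ℕ.+ 1) 1)  ≡⟨ ≡.cong (λ x → 0# + 1# * ι 1 * ι (S₂ x 1)) (ℕ.+-comm n 1) ⟩
    0# + 1# * ι 1 * ι (S₂ (suc n) 1)    ≡⟨ ≡.cong (λ x → 0# + 1# * ι 1 * ι x) (S₂-suc-1 n) ⟩
    0# + 1# * ι 1 * ι 1
      ≈⟨ solve 1 (λ one → con (+ 0) :+ one :* con (+ 1) :* con (+ 1) := one) refl 1# ⟩
    1#                                  ≈⟨ trans (pow-cong n (+-identityʳ 1#)) (pow-1# n) ⟨
    pow (ι 1) n                         ∎
  stirlingSum-row-zero (suc m) n = begin
    stirlingSum n 0 (suc M)
      ≈⟨ stirlingSum-row-zero-step M n (s≤s z≤n) ⟩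
    stirlingSum (suc n) 1 M - ι M * stirlingSum n 1 M
      ≈⟨ +-cong (row-one (suc n)) (-‿cong (*-congˡ (row-one n))) ⟩
    (monomial (suc n) (suc M) - monomial (suc n) M) - ι M * (monomial n (suc M) - monomial n M)
      ≈⟨ solve 4 (λ one μ x y → ((one :+ μ) :* x :+ :- (μ :* y)) :+ :- (μ :* (x :+ :- y)) := one :* x)
                 refl 1# (ι M) _ _ ⟩
    1# * monomial n (suc M)
      ≈⟨ *-identityˡ _ ⟩
    monomial n (suc M) ∎
    where
    M : ℕ
    M = suc m
    row-one : ∀ n → stirlingSum n 1 M ≈ monomial n (suc M) - monomial n M
    row-one n = begin
      stirlingSum n 1 M                   ≈⟨ ι1* _ ⟨
      ι 1 * stirlingSum n 1 M             ≈⟨ Δ-monomial-from-row-zero M (stirlingSum-row-zero m) n 1 ⟨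
      Δ 1 M (monomial n)                  ≈⟨ Δ-one M (monomial n) ⟩
      monomial n (suc M) - monomial n M   ∎

  -- Fails for m = 0: the sum is empty, while Δ⁰ x⁰ at 0 is 1.
  Δ-monomial≈k!*stirlingSum : ∀ m → 1 ≤ m → ∀ n k → Δ k m (monomial n) ≈ ι (k !) * stirlingSum n k m
  Δ-monomial≈k!*stirlingSum (suc m) _ = Δ-monomial-from-row-zero (suc m) (stirlingSum-row-zero m)

  Δ-polynomial₂ : ∀ k m p₁ p₂ (d : ℕ → ℕ → Carrier) → 1 ≤ m →
    Δ k m (λ x → Σ≤ p₁ (λ j₁ → Σ≤ p₂ (λ j₂ → d j₁ j₂ * monomial (j₁ ℕ.+ j₂) x))) ≈
    ι (k !) * Σ≤ p₁ (λ j₁ → Σ≤ p₂ (λ j₂ → d j₁ j₂ * stirlingSum (j₁ ℕ.+ j₂) k m))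
  Δ-polynomial₂ k m p₁ p₂ d 1≤m = begin
    Δ k m (λ x → Σ≤ p₁ (λ j₁ → Σ≤ p₂ (λ j₂ → term j₁ j₂ x)))
      ≈⟨ Δ-Σ≤ k m p₁ (λ j₁ x → Σ≤ p₂ (λ j₂ → term j₁ j₂ x)) ⟩
    Σ≤ p₁ (λ j₁ → Δ k m (λ x → Σ≤ p₂ (λ j₂ → term j₁ j₂ x)))
      ≈⟨ Σ≤-cong p₁ (λ j₁ _ → trans (Δ-Σ≤ k m p₂ (term j₁)) (Σ≤-cong p₂ (λ j₂ _ → Δ-term j₁ j₂))) ⟩
    Σ≤ p₁ (λ j₁ → Σ≤ p₂ (λ j₂ → ι (k !) * (d j₁ j₂ * stirlingSum (j₁ ℕ.+ j₂) k m)))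
      ≈⟨ trans (Σ≤-*ˡ p₁ _ _) (Σ≤-cong p₁ (λ j₁ _ → Σ≤-*ˡ p₂ _ _)) ⟨
    ι (k !) * Σ≤ p₁ (λ j₁ → Σ≤ p₂ (λ j₂ → d j₁ j₂ * stirlingSum (j₁ ℕ.+ j₂) k m)) ∎
    where
    term : ℕ → ℕ → ℕ → Carrier
    term j₁ j₂ x = d j₁ j₂ * monomial (j₁ ℕ.+ j₂) x
    Δ-term : ∀ j₁ j₂ → Δ k m (term j₁ j₂) ≈ ι (k !) * (d j₁ j₂ * stirlingSum (j₁ ℕ.+ j₂) k m)
    Δ-term j₁ j₂ = begin
      Δ k m (term j₁ j₂)                                 ≈⟨ Δ-*ˡ k m (d j₁ j₂) (monomial (j₁ ℕ.+ j₂)) ⟩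
      d j₁ j₂ * Δ k m (monomial (j₁ ℕ.+ j₂))
        ≈⟨ *-congˡ (Δ-monomial≈k!*stirlingSum m 1≤m (j₁ ℕ.+ j₂) k) ⟩
      d j₁ j₂ * (ι (k !) * stirlingSum (j₁ ℕ.+ j₂) k m)  ≈⟨ x∙yz≈y∙xz _ _ _ ⟩
      ι (k !) * (d j₁ j₂ * stirlingSum (j₁ ℕ.+ j₂) k m)  ∎

  affine-shift : ∀ a b x m → a * ι x + b ≈ a * ι (x ℕ.+ m) + (b - a * ι m)
  affine-shift a b x m = begin
    a * ι x + b
      ≈⟨ solve 4 (λ a y b μ → a :* y :+ b := a :* (y :+ μ) :+ (b :+ :- (a :* μ))) refl a (ι x) b (ι m) ⟩
    a * (ι x + ι m) + (b - a * ι m)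
      ≈⟨ +-congʳ (*-congˡ (ι-+ x m)) ⟨
    a * ι (x ℕ.+ m) + (b - a * ι m) ∎

  genS-as-Δ : ∀ kinv a₁ b₁ a₂ b₂ p₂ p₁ k m → genS kinv a₁ b₁ a₂ b₂ p₂ p₁ k ≈
    kinv * Δ k m (λ x → pow (a₁ * ι x + (b₁ - a₁ * ι m)) p₁ * pow (a₂ * ι x + (b₂ - a₂ * ι m)) p₂)
  genS-as-Δ kinv a₁ b₁ a₂ b₂ p₂ p₁ k m = *-congˡ (Σ≤-cong k (λ j _ → trans (reorder _ _ _ _)
    (*-congˡ (*-congˡ (*-cong (pow-cong p₁ (affine-shift a₁ b₁ (k ∸ j) m))
                              (pow-cong p₂ (affine-shift a₂ b₂ (k ∸ j) m)))))))
    where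
    reorder : ∀ s c x y → s * c * x * y ≈ c * (s * (x * y))
    reorder = solve 4 (λ s c x y → s :* c :* x :* y := c :* (s :* (x :* y))) refl

  binomial-coefficient₂ : (a₁ c₁ a₂ c₂ : Carrier) (p₁ p₂ j₁ j₂ : ℕ) → Carrier
  binomial-coefficient₂ a₁ c₁ a₂ c₂ p₁ p₂ j₁ j₂ =
    ι (p₁ C j₁) * ι (p₂ C j₂) * pow a₁ j₁ * pow a₂ j₂ * pow c₁ (p₁ ∸ j₁) * pow c₂ (p₂ ∸ j₂)

  binomial₂ : ∀ a₁ c₁ a₂ c₂ p₁ p₂ x → pow (a₁ * x + c₁) p₁ * pow (a₂ * x + c₂) p₂ ≈
    Σ≤ p₁ (λ j₁ → Σ≤ p₂ (λ j₂ → binomial-coefficient₂ a₁ c₁ a₂ c₂ p₁ p₂ j₁ j₂ * pow x (j₁ ℕ.+ j₂)))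
  binomial₂ a₁ c₁ a₂ c₂ p₁ p₂ x = begin
    pow (a₁ * x + c₁) p₁ * pow (a₂ * x + c₂) p₂
      ≈⟨ *-cong (binomial (a₁ * x) c₁ p₁) (binomial (a₂ * x) c₂ p₂) ⟩
    Σ≤ p₁ U * Σ≤ p₂ V
      ≈⟨ trans (Σ≤-*ʳ p₁ _ _) (Σ≤-cong p₁ (λ j₁ _ → Σ≤-*ˡ p₂ _ _)) ⟩
    Σ≤ p₁ (λ j₁ → Σ≤ p₂ (λ j₂ → U j₁ * V j₂))
      ≈⟨ Σ≤-cong p₁ (λ j₁ _ → Σ≤-cong p₂ (λ j₂ _ → UV j₁ j₂)) ⟩
    Σ≤ p₁ (λ j₁ → Σ≤ p₂ (λ j₂ → d j₁ j₂ * pow x (j₁ ℕ.+ j₂))) ∎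
    where
    d : ℕ → ℕ → Carrier
    d = binomial-coefficient₂ a₁ c₁ a₂ c₂ p₁ p₂
    U V : ℕ → Carrier
    U j₁ = ι (p₁ C j₁) * (pow (a₁ * x) j₁ * pow c₁ (p₁ ∸ j₁))
    V j₂ = ι (p₂ C j₂) * (pow (a₂ * x) j₂ * pow c₂ (p₂ ∸ j₂))
    UV : ∀ j₁ j₂ → U j₁ * V j₂ ≈ d j₁ j₂ * pow x (j₁ ℕ.+ j₂)
    UV j₁ j₂ = begin
      U j₁ * V j₂
        ≈⟨ *-cong (*-congˡ (*-congʳ (pow-distrib-* a₁ x j₁))) (*-congˡ (*-congʳ (pow-distrib-* a₂ x j₂))) ⟩
      ι (p₁ C j₁) * ((pow a₁ j₁ * pow x j₁) * pow c₁ (p₁ ∸ j₁))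
        * (ι (p₂ C j₂) * ((pow a₂ j₂ * pow x j₂) * pow c₂ (p₂ ∸ j₂)))
        ≈⟨ solve 8 (λ C₁ A₁ X₁ c₁ C₂ A₂ X₂ c₂ →
                      C₁ :* ((A₁ :* X₁) :* c₁) :* (C₂ :* ((A₂ :* X₂) :* c₂))
                   := C₁ :* C₂ :* A₁ :* A₂ :* c₁ :* c₂ :* (X₁ :* X₂)) refl _ _ _ _ _ _ _ _ ⟩
      d j₁ j₂ * (pow x j₁ * pow x j₂)
        ≈⟨ *-congˡ (pow-homo-+ x j₁ j₂) ⟨
      d j₁ j₂ * pow x (j₁ ℕ.+ j₂) ∎

  *-cancel-inverse : ∀ {u v} y → u * v ≈ 1# → v * (u * y) ≈ y
  *-cancel-inverse {u} {v} y u*v≈1 = begin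
    v * (u * y)  ≈⟨ solve 3 (λ u v y → v :* (u :* y) := (u :* v) :* y) refl u v y ⟩
    (u * v) * y  ≈⟨ *-congʳ u*v≈1 ⟩
    1# * y       ≈⟨ *-identityˡ y ⟩
    y            ∎

corollary1 : ∀ {c ℓ} (R : CommutativeRing c ℓ) →
    let open CommutativeRing R in let open Gen R in
    (a₁ b₁ a₂ b₂ : Carrier) (p₁ p₂ k m : ℕ) → 1 ≤ m →
    (kinv : Carrier) → ι (k !) * kinv ≈ 1# →
    genS kinv a₁ b₁ a₂ b₂ p₂ p₁ k ≈ rhs a₁ b₁ a₂ b₂ p₁ p₂ k m
corollary1 R a₁ b₁ a₂ b₂ p₁ p₂ k m 1≤m kinv k!*kinv≈1 = begin
  genS kinv a₁ b₁ a₂ b₂ p₂ p₁ k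
    ≈⟨ genS-as-Δ kinv a₁ b₁ a₂ b₂ p₂ p₁ k m ⟩
  kinv * Δ k m (λ x → pow (a₁ * ι x + c₁) p₁ * pow (a₂ * ι x + c₂) p₂)
    ≈⟨ *-congˡ (Δ-cong k m (λ x → binomial₂ a₁ c₁ a₂ c₂ p₁ p₂ (ι x))) ⟩
  kinv * Δ k m (λ x → Σ≤ p₁ (λ j₁ → Σ≤ p₂ (λ j₂ → d j₁ j₂ * monomial (j₁ ℕ.+ j₂) x)))
    ≈⟨ *-congˡ (Δ-polynomial₂ k m p₁ p₂ d 1≤m) ⟩
  kinv * (ι (k !) * rhs a₁ b₁ a₂ b₂ p₁ p₂ k m)
    ≈⟨ *-cancel-inverse _ k!*kinv≈1 ⟩
  rhs a₁ b₁ a₂ b₂ p₁ p₂ k m ∎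
  where
  open CommutativeRing R
  open Gen R
  open ForwardDifferences R
  open import Relation.Binary.Reasoning.Setoid setoid
  c₁ c₂ : Carrier
  c₁ = b₁ - a₁ * ι m
  c₂ = b₂ - a₂ * ι m
  d : ℕ → ℕ → Carrier
  d = binomial-coefficient₂ a₁ c₁ a₂ c₂ p₁ p₂
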